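{- If the statement $\Phi_4$ holds, then there are infinitely many positive integers $m$ such that $m!+1$ is prime.
   Context: Define $f:\{1,2,3,\ldots\}\to\mathbb{N}$ by $f(1)=2$, $f(2)=3$, and $f(n+1)=f(n)!$ for every integer $n\geqslant 2$. Write $x\not\mid y$ to mean that $x$ does not divide $y$. For a positive integer $n$, $\Phi_n$ denotes the statement: for every system $\mathcal{S}$ that is a subset of $\{x_i+1=x_k,\ x_i!=x_k,\ x_i\not\mid x_k : i,k\in\{1,\ldots,n\}\}$, if $\mathcal{S}$ has only finitely many solutions in positive integers $x_1,\ldots,x_n$, then every such solution $(x_1,\ldots,x_n)$ satisfies $x_1,\ldots,x_n\leqslant f(n)$. -}

module Defs where

open import Data.Nat using (ℕ; zero; suc; _+_; _≤_; _<_; _!)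
open import Data.Nat.Divisibility using (_∣_)
open import Data.Nat.Primality using (Prime)
open import Data.Fin using (Fin)
open import Data.Vec using (Vec; lookup)
open import Data.List using (List)
open import Data.List.Membership.Propositional using (_∈_)
open import Data.List.Relation.Unary.All using (All)
open import Data.Product using (Σ; ∃; ∃-syntax; _×_)
open import Relation.Binary.PropositionalEquality using (_≡_)
open import Relation.Nullary using (¬_)

-- f(1) = 2, f(2) = 3, f(n+1) = f(n)! for n ≥ 2.  (f 0 is an unused junk value.)
f : ℕ → ℕ
f zero = 2
f (suc zero) = 2
f (suc (suc zero)) = 3
f (suc (suc (suc n))) = f (suc (suc n)) !

data Equation (n : ℕ) : Set where
  succ-eq : Fin n → Fin n → Equation n
  fact-eq : Fin n → Fin n → Equation n
  ndiv-eq : Fin n → Fin n → Equation n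

System : ℕ → Set
System n = List (Equation n)

_⊨_ : {n : ℕ} → Vec ℕ n → Equation n → Set
x ⊨ succ-eq i k = lookup x i + 1 ≡ lookup x k
x ⊨ fact-eq i k = lookup x i ! ≡ lookup x k
x ⊨ ndiv-eq i k = ¬ (lookup x i ∣ lookup x k)

IsSolution : {n : ℕ} → System n → Vec ℕ n → Set
IsSolution {n} S x = ((i : Fin n) → 0 < lookup x i) × All (x ⊨_) S

FinitelyManySolutions : {n : ℕ} → System n → Set
FinitelyManySolutions {n} S = ∃[ L ] ((x : Vec ℕ n) → IsSolution S x → x ∈ L)

Φ : ℕ → Set
Φ n = (S : System n) → FinitelyManySolutions S →
      (x : Vec ℕ n) → IsSolution S x → (i : Fin n) → lookup x i ≤ f n

InfinitelyMany : (ℕ → Set) → Set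
InfinitelyMany P = ¬ (∃[ L ] ((m : ℕ) → P m → m ∈ L))

module Submission where

-- Consider the system S in four unknowns
--     x₁! = x₂ ,  x₂ + 1 = x₃ ,  x₂! = x₄ ,  x₃ ∤ x₄ .
-- Its solutions are exactly (m, m!, m! + 1, (m!)!) with x₃ ∤ x₄, i.e. with
-- m! + 1 ∤ (m!)!.  By a Wilson-type criterion (a prime p never divides
-- (p - 1)!, while every composite n ≠ 4 divides (n - 1)!), and since
-- m! + 1 ≠ 4, this condition says precisely that m! + 1 is prime.
-- So if only finitely many m had m! + 1 prime, S would have only finitely
-- many solutions, and Φ₄ would bound all of them by f(4) = 720.  But
-- 11! + 1 is prime (checked by trial division), and the corresponding
-- solution has x₂ = 11! > 720.

open import Defs
open import Data.Nat using (ℕ; _+_; _<_; _!)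
open import Data.Nat.Primality using (Prime)
open import Data.Product using (_×_)

open import Data.Nat using (zero; suc; _*_; _≤_; z≤n; s≤s; _<?_; nonTrivial⇒n>1)
open import Data.Nat.Properties
open import Data.Nat.Divisibility
open import Data.Nat.Primality
  using (_Rough_; 2-rough; ∤⇒rough-suc; rough∧square>⇒prime; Composite; composite;
         composite?; prime; ¬prime[1]; euclidsLemma)
open import Data.Bool using (Bool; true; _∧_; T)
open import Data.Bool.Properties using (T-∧)
open import Data.Product using (_,_; proj₁; proj₂)
open import Data.Sum using (inj₁; inj₂)
open import Data.Empty using (⊥-elim)
open import Data.Fin using (Fin; zero; suc)
open import Data.Vec using (Vec; []; _∷_; lookup)
open import Data.List using (List; map; []; _∷_)
open import Data.List.Membership.Propositional using (_∈_)
open import Data.List.Membership.Propositional.Properties using (∈-map⁺)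
open import Data.List.Relation.Unary.All using ([]; _∷_)
open import Function.Bundles using (Equivalence)
open import Relation.Nullary using (¬_; yes; no)
open import Relation.Nullary.Decidable using (isNo; toWitness; toWitnessFalse)
open import Relation.Binary.PropositionalEquality
  using (_≡_; _≢_; refl; sym; trans; cong; subst)
open import Relation.Binary.Definitions using (tri<; tri≈; tri>)

trialDivision : ℕ → ℕ → Bool
trialDivision n zero    = true
trialDivision n (suc k) = isNo (2 + k ∣? n) ∧ trialDivision n k

trialDivision⇒rough : ∀ n k → T (trialDivision n k) → (2 + k) Rough n
trialDivision⇒rough n zero    _  = 2-rough
trialDivision⇒rough n (suc k) ok =
  ∤⇒rough-suc (toWitnessFalse {a? = 2 + k ∣? n} (proj₁ checks))
              (trialDivision⇒rough n k (proj₂ checks))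
  where
  checks : T (isNo (2 + k ∣? n)) × T (trialDivision n k)
  checks = Equivalence.to (T-∧ {isNo (2 + k ∣? n)}) ok

-- 11! + 1 = 39916801 is prime: it has no divisor below 6319 and 6319² exceeds it.
prime[11!+1] : Prime (11 ! + 1)
prime[11!+1] = rough∧square>⇒prime (trialDivision⇒rough (11 ! + 1) 6317 _)
                                    (toWitness {a? = 11 ! + 1 <? 6319 * 6319} _)

divisor∣factorial : ∀ {a n} → 0 < a → a ≤ n → a ∣ n !
divisor∣factorial {suc a} _ a<n = ∣-trans (m∣m*n (a !)) (m≤n⇒m!∣n! a<n)

-- If 0 < a < b ≤ n then a · b divides n!: b! = b · (b - 1)! and a ∣ (b - 1)!.
ordered-product∣factorial : ∀ {a b n} → 0 < a → a < b → b ≤ n → a * b ∣ n !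
ordered-product∣factorial {a} {suc b} 0<a (s≤s a≤b) b<n =
  ∣-trans (subst (_∣ suc b * b !) (*-comm (suc b) a) (*-monoʳ-∣ (suc b) (divisor∣factorial 0<a a≤b)))
          (m≤n⇒m!∣n! b<n)

distinct-product∣factorial : ∀ {a b n} → 0 < a → 0 < b → a ≢ b → a ≤ n → b ≤ n → a * b ∣ n !
distinct-product∣factorial {a} {b} {n} 0<a 0<b a≢b a≤n b≤n with <-cmp a b
... | tri< a<b _ _ = ordered-product∣factorial 0<a a<b b≤n
... | tri≈ _ a≡b _ = ⊥-elim (a≢b a≡b)
... | tri> _ _ b<a = subst (_∣ n !) (*-comm b a) (ordered-product∣factorial 0<b b<a a≤n)

-- For d ≥ 3 the square d² divides (d² - 1)!: d and 2d are distinct factors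
-- below d², and d² ∣ d · 2d.
square∣factorial : ∀ {d k} → 3 ≤ d → d * d ≡ suc k → d * d ∣ k !
square∣factorial {d@(suc _)} {k} 3≤d d²≡1+k =
  ∣-trans (*-monoʳ-∣ d (n∣m*n 2 {d}))
          (distinct-product∣factorial (s≤s z≤n) (s≤s z≤n) d≢2d (≤-trans (m≤n*m d 2) 2d≤k) 2d≤k)
  where
  d<2d : d < 2 * d
  d<2d = subst (d <_) (*-comm d 2) (m<m*n d 2 (s≤s (s≤s z≤n)))
  d≢2d : d ≢ 2 * d
  d≢2d = <⇒≢ d<2d
  2d≤k : 2 * d ≤ k
  2d≤k = ≤-pred (subst (2 * d <_) d²≡1+k (*-monoˡ-< d 3≤d))

-- Every composite n ≠ 4 divides (n - 1)!: write n = q · d with proper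
-- divisors d, q; if d ≠ q use the two distinct factors, if d = q then d ≥ 3.
composite∣factorial : ∀ {k} → Composite (suc k) → suc k ≢ 4 → suc k ∣ k !
composite∣factorial {k} (composite {d} d<n d∣n) n≢4 with d ≟ quotient d∣n
... | no d≢q = subst (_∣ k !) (trans (*-comm d q) (sym n≡q*d))
                 (distinct-product∣factorial (≤-trans (s≤s z≤n) 2≤d) (≤-trans (s≤s z≤n) 2≤q) d≢q
                   (≤-pred d<n) (≤-pred (quotient-< d∣n)))
  where
  q : ℕ
  q = quotient d∣n
  n≡q*d : suc k ≡ q * d
  n≡q*d = m∣n⇒n≡quotient*m d∣n
  2≤d : 2 ≤ d
  2≤d = nonTrivial⇒n>1 d
  2≤q : 2 ≤ q
  2≤q = quotient>1 d∣n d<n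
... | yes d≡q = subst (_∣ k !) (sym n≡d*d)
                  (square∣factorial (root≥3 d (nonTrivial⇒n>1 d) (λ d*d≡4 → n≢4 (trans n≡d*d d*d≡4)))
                                    (sym n≡d*d))
  where
  n≡d*d : suc k ≡ d * d
  n≡d*d = trans (m∣n⇒n≡quotient*m d∣n) (cong (_* d) (sym d≡q))
  root≥3 : ∀ d → 2 ≤ d → d * d ≢ 4 → 3 ≤ d
  root≥3 (suc zero)          (s≤s ()) _
  root≥3 (suc (suc zero))    _ d*d≢4 = ⊥-elim (d*d≢4 refl)
  root≥3 (suc (suc (suc _))) _ _     = s≤s (s≤s (s≤s z≤n))

prime∤factorial : ∀ {p} → Prime p → ∀ k → k < p → ¬ (p ∣ k !)
prime∤factorial p-prime zero    _   p∣1 = ¬prime[1] (subst Prime (∣1⇒≡1 p∣1) p-prime)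
prime∤factorial p-prime (suc k) k<p p∣k! with euclidsLemma (suc k) (k !) p-prime p∣k!
... | inj₁ p∣1+k = <⇒≱ k<p (∣⇒≤ p∣1+k)
... | inj₂ p∣k!′ = prime∤factorial p-prime k (<-trans (n<1+n k) k<p) p∣k!′

∤factorial⇒prime : ∀ k → k + 1 ≢ 4 → ¬ (k + 1 ∣ k !) → Prime (k + 1)
∤factorial⇒prime k n≢4 n∤k! rewrite +-comm k 1 with composite? (suc k)
... | yes n-composite = ⊥-elim (n∤k! (composite∣factorial n-composite n≢4))
... | no ¬composite with k
...   | zero  = ⊥-elim (n∤k! ∣-refl)
...   | suc _ = prime ¬composite

-- m! + 1 is never 4, because m! is never 3: for m ≥ 2 it is even.
m!+1≢4 : ∀ m → m ! + 1 ≢ 4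
m!+1≢4 zero          ()
m!+1≢4 (suc zero)    ()
m!+1≢4 (suc (suc m)) m!+1≡4 = 2∤3 (subst (2 ∣_) m!≡3 (divisor∣factorial {n = suc (suc m)} (s≤s z≤n) (s≤s (s≤s z≤n))))
  where
  m!≡3 : suc (suc m) ! ≡ 3
  m!≡3 = +-cancelʳ-≡ 1 _ 3 m!+1≡4
  2∤3 : ¬ (2 ∣ 3)
  2∤3 = toWitnessFalse {a? = 2 ∣? 3} _

S : System 4
S = fact-eq zero (suc zero)
  ∷ succ-eq (suc zero) (suc (suc zero))
  ∷ fact-eq (suc zero) (suc (suc (suc zero)))
  ∷ ndiv-eq (suc (suc zero)) (suc (suc (suc zero)))
  ∷ []

solutionFor : ℕ → Vec ℕ 4
solutionFor m = m ∷ m ! ∷ m ! + 1 ∷ (m !) ! ∷ []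

solutionFor-isSolution : ∀ m → 0 < m → Prime (m ! + 1) → IsSolution S (solutionFor m)
solutionFor-isSolution m 0<m m!+1-prime = positive , (refl ∷ refl ∷ refl ∷ m!+1∤[m!]! ∷ [])
  where
  positive : (i : Fin 4) → 0 < lookup (solutionFor m) i
  positive zero                   = 0<m
  positive (suc zero)             = 1≤n! m
  positive (suc (suc zero))       = ≤-trans (s≤s z≤n) (m<m+n (m !) (s≤s z≤n))
  positive (suc (suc (suc zero))) = 1≤n! (m !)
  m!+1∤[m!]! : ¬ (m ! + 1 ∣ (m !) !)
  m!+1∤[m!]! = prime∤factorial m!+1-prime (m !) (m<m+n (m !) (s≤s z≤n))

-- Every solution of S is a candidate solutionFor m with m > 0 and m! + 1
-- prime; hence finitely many such m give finitely many solutions.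
finitely-many-primes⇒finitely-many-solutions :
  (L : List ℕ) → ((m : ℕ) → 0 < m × Prime (m ! + 1) → m ∈ L) → FinitelyManySolutions S
finitely-many-primes⇒finitely-many-solutions L covers = map solutionFor L , covered
  where
  covered : (x : Vec ℕ 4) → IsSolution S x → x ∈ map solutionFor L
  covered (a ∷ .(a !) ∷ .(a ! + 1) ∷ .((a !) !) ∷ []) (positive , (refl ∷ refl ∷ refl ∷ a!+1∤[a!]! ∷ [])) =
    ∈-map⁺ solutionFor (covers a (positive zero , ∤factorial⇒prime (a !) (m!+1≢4 a) a!+1∤[a!]!))

theorem1 : Φ 4 → InfinitelyMany (λ m → 0 < m × Prime (m ! + 1))
theorem1 Φ₄ (L , covers) = <⇒≱ f[4]<11! 11!≤f[4]
  where
  11!≤f[4] : 11 ! ≤ f 4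
  11!≤f[4] = Φ₄ S (finitely-many-primes⇒finitely-many-solutions L covers)
                (solutionFor 11) (solutionFor-isSolution 11 (s≤s z≤n) prime[11!+1]) (suc zero)
  f[4]<11! : f 4 < 11 !
  f[4]<11! = toWitness {a? = f 4 <? 11 !} _
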